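{- Let $G=(V,E)$ be a directed graph on $n$ vertices whose underlying undirected graph has diameter $1$. For every $x\in V$ and $i\in\{0,\dots,n-1\}$, if $f_{i+1}[x]\ne\perp$ then $f_i[x]\ne\perp$ and $f_i[x]<f_{i+1}[x]$.
   Context: Directed graphs are simple (anti-parallel edges allowed). $N_{out}(x)$ is the set of out-neighbours of $x$ and $d_{out}$ the out-degree. For each integer $0\le i<n$, let $A(i)=\{u\in V: d_{out}(u)>i \text{ and there is } w\in V \text{ with } (w,u)\in E \text{ and } d_{out}(w)\le i\}$, and $M(i)=\perp$ if $A(i)=\varnothing$, otherwise $M(i)=\max\{d_{out}(v): v\in A(i)\}$. For $x\in V$ let $f_0[x]=\max\{d_{out}(v): v\in\{x\}\cup N_{out}(x)\}$, and for $k\in\{1,\dots,n\}$ let $f_k[x]=\perp$ if $f_{k-1}[x]=\perp$ and $f_k[x]=M(f_{k-1}[x])$ otherwise. -}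

module Defs where

open import Data.Bool using (Bool; true; false; _∧_)
open import Data.Nat using (ℕ; zero; suc; _⊔_; _<ᵇ_; _≤ᵇ_)
open import Data.Fin using (Fin)
open import Data.List using (List; []; _∷_; length; filterᵇ; map; foldr)
open import Data.Bool.ListAction using (any)
open import Relation.Binary.PropositionalEquality using (_≡_)
open import Data.List using () renaming (allFin to allFinL)
open import Data.Maybe using (Maybe; just; nothing; _>>=_)

-- A directed graph on vertex set Fin n, given by its (Boolean) adjacency relation:
-- Edge u v ≡ true  iff  (u , v) ∈ E.
Digraph : ℕ → Set
Digraph n = Fin n → Fin n → Bool

-- the graph is simple: no loops (anti-parallel edges are allowed)
Loopless : ∀ {n} → Digraph n → Set
Loopless {n} G = (x : Fin n) → G x x ≡ false

vertices : (n : ℕ) → List (Fin n)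
vertices n = allFinL n

Nout : ∀ {n} → Digraph n → Fin n → List (Fin n)
Nout {n} G x = filterᵇ (G x) (vertices n)

dout : ∀ {n} → Digraph n → Fin n → ℕ
dout G x = length (Nout G x)

maxList : List ℕ → Maybe ℕ
maxList [] = nothing
maxList (a ∷ as) = just (foldr _⊔_ a as)

inA : ∀ {n} → Digraph n → ℕ → Fin n → Bool
inA {n} G i u = (i <ᵇ dout G u) ∧ any (λ w → G w u ∧ (dout G w ≤ᵇ i)) (vertices n)

A : ∀ {n} → Digraph n → ℕ → List (Fin n)
A {n} G i = filterᵇ (inA G i) (vertices n)

M : ∀ {n} → Digraph n → ℕ → Maybe ℕ
M G i = maxList (map (dout G) (A G i))

f : ∀ {n} → Digraph n → ℕ → Fin n → Maybe ℕ
f G zero x = maxList (map (dout G) (x ∷ Nout G x))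
f G (suc k) x = f G k x >>= M G

module Submission where

-- The only fact about M that matters is that it is strictly increasing:
-- every vertex u of A(i) satisfies d_out(u) > i by definition, so the
-- maximum M(i) of their out-degrees, when it exists, exceeds i.  Since
-- f_{i+1}[x] = M(f_i[x]) whenever f_i[x] ≠ ⊥ (and ⊥ otherwise), the claim
-- follows at once.

open import Defs
open import Data.Bool using (T; T?; true)
open import Data.Bool.Properties using (T-∧)
open import Data.Nat using (ℕ; suc; _<_; _≤_; _⊔_)
open import Data.Nat.Properties using (<ᵇ⇒<; m≤n⊔m; ≤-refl; ≤-trans; <-≤-trans)
open import Data.Fin using (Fin)
open import Data.List using (List; []; _∷_; map; foldr)
open import Data.List.Relation.Unary.All as All using (All; _∷_)
open import Data.List.Relation.Unary.All.Properties using (all-filter; map⁺)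
open import Data.Maybe using (just; nothing)
open import Data.Product using (∃; _×_; _,_; proj₁)
open import Data.Sum using (_⊎_)
open import Function using (_∘_)
open import Function.Bundles using (Equivalence)
open import Relation.Binary.PropositionalEquality using (_≡_; _≢_; refl)

seed≤foldr-⊔ : (c : ℕ) (cs : List ℕ) → c ≤ foldr _⊔_ c cs
seed≤foldr-⊔ c []       = ≤-refl
seed≤foldr-⊔ c (d ∷ cs) = ≤-trans (seed≤foldr-⊔ c cs) (m≤n⊔m d (foldr _⊔_ c cs))

maxList-above : ∀ {a b} (xs : List ℕ) → All (a <_) xs → maxList xs ≡ just b → a < b
maxList-above (c ∷ cs) (a<c ∷ _) refl = <-≤-trans a<c (seed≤foldr-⊔ c cs)

A-above : ∀ {n} (G : Digraph n) (i : ℕ) → All (λ u → i < dout G u) (A G i)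
A-above {n} G i = All.map degree-above (all-filter (T? ∘ inA G i) (vertices n))
  where
  degree-above : ∀ {u} → T (inA G i u) → i < dout G u
  degree-above {u} inA-u = <ᵇ⇒< i (dout G u) (proj₁ (Equivalence.to T-∧ inA-u))

M-increasing : ∀ {n} (G : Digraph n) (i b : ℕ) → M G i ≡ just b → i < b
M-increasing G i b = maxList-above (map (dout G) (A G i)) (map⁺ (A-above G i))

claim4 : (n : ℕ) (G : Digraph n) → Loopless G
    → 2 ≤ n
    → ((u v : Fin n) → u ≢ v → G u v ≡ true ⊎ G v u ≡ true)
    → (x : Fin n) (i : ℕ) → i < n
    → (b : ℕ) → f G (suc i) x ≡ just b
    → ∃ λ a → f G i x ≡ just a × a < b
claim4 n G _ _ _ x i _ b f-suc-i≡b with f G i x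
... | nothing with f-suc-i≡b
...   | ()
claim4 n G _ _ _ x i _ b f-suc-i≡b | just a = a , refl , M-increasing G a b f-suc-i≡b
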